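{- For every $d\in\mathbb N$, the family of graphs with maximal degree $d$ has a labeling scheme (in the adversarial model described in the context) with labels of size $O(\log d)$ bits and probability of forgery at most $1-\Omega(1/d)$.
   Context: A labeling scheme (adjacency sketch) for a family of graphs consists of a randomized encoder that, given a graph $G$ in the family, outputs a labeling $\ell:V(G)\to\{0,1\}^c$ ($c$ is the size), and a deterministic decoder $\mathcal D:\{0,1\}^*\times\{0,1\}^*\to\{0,1\}$; the scheme errs only on non-edges, i.e. $\mathcal D(\ell(u),\ell(v))=1$ always holds for edges $(u,v)$. Adversarial game: the adversary chooses $G$ in the family with $n$ vertices; labels are drawn by the encoder; the (computationally unbounded) adversary adaptively requests the labels of vertices $x_1,\dots,x_k$, $k\le n-2$, each choice possibly depending on earlier answers; it then names two distinct vertices $x_{k+1},x_{k+2}$ not previously queried. It wins if $(x_{k+1},x_{k+2})\notin E(G)$ but $\mathcal D(\ell(x_{k+1}),\ell(x_{k+2}))=1$. The probability of forgery is the maximum over adversaries of the winning probability. -}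

module Defs where

open import Data.Nat using (ℕ; zero; suc; _+_; _*_; _≤_)
open import Data.Bool using (Bool; true; false; not; _∧_; _∨_; if_then_else_)
open import Data.Fin using (Fin; _≟_)
open import Data.Vec using (Vec)
open import Data.List using (List; []; _∷_; map; allFin)
open import Data.Nat.ListAction using (sum)
open import Data.Bool.ListAction using (any)
open import Data.Product using (_×_; _,_)
open import Relation.Nullary using (does)
open import Relation.Binary.PropositionalEquality using (_≡_)

Graph : ℕ → Set
Graph n = Fin n → Fin n → Bool

IsSimple : {n : ℕ} → Graph n → Set
IsSimple {n} G = (∀ (u v : Fin n) → G u v ≡ G v u) × (∀ (u : Fin n) → G u u ≡ false)

countTrue : {m : ℕ} → (Fin m → Bool) → ℕ
countTrue {m} f = sum (map (λ i → if f i then 1 else 0) (allFin m))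

degree : {n : ℕ} → Graph n → Fin n → ℕ
degree G v = countTrue (G v)

MaxDegree≤ : ℕ → {n : ℕ} → Graph n → Set
MaxDegree≤ d {n} G = ∀ (v : Fin n) → degree G v ≤ d

Label : ℕ → Set
Label c = Vec Bool c

-- The randomized encoder is
-- modelled by a finite, non-empty seed space (uniformly distributed coins)
-- whose size may depend on the input graph; the decoder is deterministic.
record Scheme (c : ℕ) : Set where
  field
    seeds     : (n : ℕ) → Graph n → ℕ
    seeds-pos : (n : ℕ) (G : Graph n) → 1 ≤ seeds n G
    encode    : (n : ℕ) (G : Graph n) → Fin (seeds n G) → Fin n → Label c
    decode    : Label c → Label c → Bool
open Scheme public

-- The scheme errs only on non-edges (one-sided error), for graphs in the
-- family of maximal degree at most d.
Complete : ℕ → {c : ℕ} → Scheme c → Set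
Complete d S = ∀ (n : ℕ) (G : Graph n) → IsSimple G → MaxDegree≤ d G →
  ∀ (s : Fin (seeds S n G)) (u v : Fin n) → G u v ≡ true →
  decode S (encode S n G s u) (encode S n G s v) ≡ true

-- An adaptive, computationally unbounded adversary: a decision tree which
-- either queries the label of a vertex and continues depending on the
-- answer, or stops and names two vertices.
data Adversary (n c : ℕ) : Set where
  query : Fin n → (Label c → Adversary n c) → Adversary n c
  guess : Fin n → Fin n → Adversary n c

run : {n c : ℕ} → Adversary n c → (Fin n → Label c) → List (Fin n) × (Fin n × Fin n)
run (guess x y) L = [] , (x , y)
run (query x k) L with run (k (L x)) L
... | qs , p = (x ∷ qs) , p

_∈ᵇ_ : {n : ℕ} → Fin n → List (Fin n) → Bool
x ∈ᵇ qs = any (λ q → does (x ≟ q)) qs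

wins : {n c : ℕ} → (Label c → Label c → Bool) → Graph n →
       (Fin n → Label c) → Adversary n c → Bool
wins D G L A with run A L
... | qs , (x , y) =
  not (does (x ≟ y)) ∧ not (x ∈ᵇ qs) ∧ not (y ∈ᵇ qs) ∧ not (G x y) ∧ D (L x) (L y)

winCount : {c : ℕ} (S : Scheme c) (n : ℕ) (G : Graph n) → Adversary n c → ℕ
winCount S n G A = countTrue (λ s → wins (decode S) G (encode S n G s) A)

-- Probability of forgery at most 1 - p/(q*d):
--   winCount / seeds ≤ 1 - p/(q d)  ⇔  winCount * (q d) + p * seeds ≤ (q d) * seeds
ForgeryBound : (d p q : ℕ) {c : ℕ} → Scheme c → Set
ForgeryBound d p q S = ∀ (n : ℕ) (G : Graph n) → IsSimple G → MaxDegree≤ d G →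
  ∀ (A : Adversary n _) →
  winCount S n G A * (q * d) + p * seeds S n G ≤ (q * d) * seeds S n G

-- Label each vertex by its colour in a random proper colouring with K = 2^k colours,
-- 3d ≤ K ≤ 8d, and let the decoder answer 1 iff the two labels differ: adjacent
-- vertices always receive different colours.  Fix the colours the adversary has seen.
-- For non-adjacent unseen x ≠ y, a proper colouring has at least K − 2d ≥ K/3 colours
-- free at both x and y, and recolouring both with such a colour keeps it proper, so
-- double counting over the K² recolourings of (x, y) shows that at least a 1/(3K)
-- fraction of the consistent proper colourings give x and y the same colour, where the
-- adversary loses.  With k = 3 + ⌊log₂ d⌋ this bounds the forgery probability by
-- 1 − 1/(25d).

module Submission where

open import Defs
open import Data.Nat using (ℕ; suc; _+_; _*_; _≤_)
open import Data.Nat.Logarithm using (⌊log₂_⌋)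
open import Data.Product using (Σ; _×_)

open import Data.Bool using (Bool; true; false; not; _∧_; _∨_; if_then_else_)
open import Data.Bool.ListAction using (any; or)
open import Data.Bool.Properties using (not-injective; not-involutive; ∨-identityʳ; ∨-assoc; ∨-comm)
  renaming (_≟_ to _≟ᵇ_)
open import Data.Empty using (⊥)
open import Data.Fin using (Fin; zero; suc) renaming (_≟_ to _≟ᶠ_)
open import Data.Fin.Properties using (all?)
open import Data.List using (List; []; _∷_; _++_; map; length; concatMap; filter; allFin)
import Data.List as List
open import Data.List.Membership.Propositional using (_∈_)
open import Data.List.Membership.Propositional.Properties using (∈-allFin; ∈-lookup)
open import Data.List.Properties using (map-cong; map-tabulate; tabulate-lookup)
open import Data.List.Relation.Unary.All using (All; _∷_)
import Data.List.Relation.Unary.All as All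
open import Data.List.Relation.Unary.All.Properties using (all-filter)
open import Data.List.Relation.Unary.Any using (here; there)
open import Data.Nat using (zero; _^_; _<_; z≤n; s≤s; NonZero; >-nonZero; ⌊_/2⌋)
open import Data.Nat.Induction using (<-wellFounded)
open import Data.Nat.ListAction using (sum)
open import Data.Nat.Logarithm.Core using (⌊log2⌋)
open import Data.Nat.Properties hiding (_≟_)
open import Algebra.Properties.CommutativeSemigroup +-commutativeSemigroup using (interchange)
open import Algebra.Properties.CommutativeSemigroup *-commutativeSemigroup using (x∙yz≈y∙xz)
open import Data.Product using (proj₁; proj₂; _,_)
open import Data.Sum using (_⊎_; inj₁; inj₂)
open import Data.Unit using (⊤; tt)
open import Data.Vec using (Vec; []; _∷_; lookup; replicate; _[_]≔_)
open import Data.Vec.Properties using (≡-dec; lookup∘update; lookup∘update′; []≔-commutes; []≔-idempotent)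
open import Function using (id; _∘_)
open import Function.Bundles using (mk⇔)
open import Induction.WellFounded using (Acc; acc)
open import Relation.Binary.Definitions using (DecidableEquality)
open import Relation.Binary.PropositionalEquality
open import Relation.Nullary using (Dec; does; yes; no; ¬?; contradiction)
open import Relation.Nullary.Decidable using (dec-true; dec-false; does-⇔; _→-dec_)
open import Relation.Unary using (Decidable)

when : Bool → ℕ → ℕ
when b m = if b then m else 0

⟦_⟧ : Bool → ℕ
⟦ b ⟧ = when b 1

-- countTrue f, hence degree G x, unfolds to ∑ (allFin _) (λ i → ⟦ f i ⟧).
∑ : {A : Set} → List A → (A → ℕ) → ℕ
∑ xs f = sum (map f xs)

when-≤ : ∀ b m → when b m ≤ m
when-≤ true  m = ≤-refl
when-≤ false m = z≤n

when-0 : ∀ b → when b 0 ≡ 0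
when-0 true  = refl
when-0 false = refl

when-comm : ∀ a b m → when a (when b m) ≡ when b (when a m)
when-comm true  b m = refl
when-comm false true  m = refl
when-comm false false m = refl

when≡*⟦⟧ : ∀ b m → when b m ≡ m * ⟦ b ⟧
when≡*⟦⟧ true  m = sym (*-identityʳ m)
when≡*⟦⟧ false m = sym (*-zeroʳ m)

⟦∧⟧ : ∀ a b → ⟦ a ∧ b ⟧ ≡ when a ⟦ b ⟧
⟦∧⟧ true  b = refl
⟦∧⟧ false b = refl

module _ {A : Set} where

  ∑-cong : ∀ xs {f g : A → ℕ} → (∀ x → f x ≡ g x) → ∑ xs f ≡ ∑ xs g
  ∑-cong []       f≗g = refl
  ∑-cong (x ∷ xs) f≗g = cong₂ _+_ (f≗g x) (∑-cong xs f≗g)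

  ∑-mono-≤ : ∀ xs {f g : A → ℕ} → (∀ x → f x ≤ g x) → ∑ xs f ≤ ∑ xs g
  ∑-mono-≤ []       f≤g = z≤n
  ∑-mono-≤ (x ∷ xs) f≤g = +-mono-≤ (f≤g x) (∑-mono-≤ xs f≤g)

  ∑-++ : ∀ xs ys (f : A → ℕ) → ∑ (xs ++ ys) f ≡ ∑ xs f + ∑ ys f
  ∑-++ []       ys f = refl
  ∑-++ (x ∷ xs) ys f = trans (cong (f x +_) (∑-++ xs ys f)) (sym (+-assoc (f x) _ _))

  ∑-+ : ∀ xs (f g : A → ℕ) → ∑ xs (λ x → f x + g x) ≡ ∑ xs f + ∑ xs g
  ∑-+ []       f g = refl
  ∑-+ (x ∷ xs) f g = trans (cong (f x + g x +_) (∑-+ xs f g)) (interchange (f x) (g x) _ _)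

  ∑-*ˡ : ∀ xs c (f : A → ℕ) → ∑ xs (λ x → c * f x) ≡ c * ∑ xs f
  ∑-*ˡ []       c f = sym (*-zeroʳ c)
  ∑-*ˡ (x ∷ xs) c f = trans (cong (c * f x +_) (∑-*ˡ xs c f)) (sym (*-distribˡ-+ c (f x) _))

  ∑-const : ∀ xs c → ∑ {A} xs (λ _ → c) ≡ length xs * c
  ∑-const []       c = refl
  ∑-const (x ∷ xs) c = cong (c +_) (∑-const xs c)

  ∑-when : ∀ xs b (f : A → ℕ) → ∑ xs (λ x → when b (f x)) ≡ when b (∑ xs f)
  ∑-when xs true  f = refl
  ∑-when xs false f = trans (∑-const xs 0) (*-zeroʳ (length xs))

length≡∑1 : {A : Set} (xs : List A) → length xs ≡ ∑ xs (λ _ → 1)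
length≡∑1 xs = sym (trans (∑-const xs 1) (*-identityʳ (length xs)))

∑-map : {A B : Set} (g : A → B) (xs : List A) (f : B → ℕ) → ∑ (map g xs) f ≡ ∑ xs (f ∘ g)
∑-map g []       f = refl
∑-map g (x ∷ xs) f = cong (f (g x) +_) (∑-map g xs f)

∑-comm : {A B : Set} (xs : List A) (ys : List B) (f : A → B → ℕ) →
         ∑ xs (λ x → ∑ ys (f x)) ≡ ∑ ys (λ y → ∑ xs (λ x → f x y))
∑-comm []       ys f = sym (trans (∑-const ys 0) (*-zeroʳ (length ys)))
∑-comm (x ∷ xs) ys f = trans (cong (∑ ys (f x) +_) (∑-comm xs ys f)) (sym (∑-+ ys (f x) _))

∑-concatMap : {A B : Set} (g : A → List B) (xs : List A) (f : B → ℕ) →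
              ∑ (concatMap g xs) f ≡ ∑ xs (λ x → ∑ (g x) f)
∑-concatMap g []       f = refl
∑-concatMap g (x ∷ xs) f = trans (∑-++ (g x) _ f) (cong (∑ (g x) f +_) (∑-concatMap g xs f))

∑-filter : {A : Set} {P : A → Set} (P? : Decidable P) (xs : List A) (f : A → ℕ) →
           ∑ (filter P? xs) f ≡ ∑ xs (λ x → when (does (P? x)) (f x))
∑-filter P? []       f = refl
∑-filter P? (x ∷ xs) f with does (P? x)
... | true  = cong (f x +_) (∑-filter P? xs f)
... | false = ∑-filter P? xs f

∑-allFin-lookup : {A : Set} (xs : List A) (f : A → ℕ) → ∑ (allFin (length xs)) (f ∘ List.lookup xs) ≡ ∑ xs f
∑-allFin-lookup xs f = cong sum (trans (map-tabulate id (f ∘ List.lookup xs))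
                                       (trans (sym (map-tabulate (List.lookup xs) f)) (cong (map f) (tabulate-lookup xs))))

record IsEnumeration {A : Set} (_≟_ : DecidableEquality A) (xs : List A) : Set where
  constructor occursOnce
  field occurrences≡1 : ∀ a → ∑ xs (λ x → ⟦ does (a ≟ x) ⟧) ≡ 1
open IsEnumeration

≟-sym : {A : Set} (_≟_ : DecidableEquality A) (a b : A) → does (a ≟ b) ≡ does (b ≟ a)
≟-sym _≟_ a b = does-⇔ (mk⇔ sym sym) (a ≟ b) (b ≟ a)

module _ {A : Set} {_≟_ : DecidableEquality A} {xs : List A} (enum : IsEnumeration _≟_ xs) where

  ∑-pick : ∀ a (f : A → ℕ) → (∀ x → a ≢ x → f x ≡ 0) → ∑ xs f ≡ f a
  ∑-pick a f vanish = begin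
    ∑ xs f                               ≡⟨ ∑-cong xs concentrate ⟩
    ∑ xs (λ x → f a * ⟦ does (a ≟ x) ⟧)  ≡⟨ ∑-*ˡ xs (f a) _ ⟩
    f a * ∑ xs (λ x → ⟦ does (a ≟ x) ⟧)  ≡⟨ cong (f a *_) (occurrences≡1 enum a) ⟩
    f a * 1                              ≡⟨ *-identityʳ (f a) ⟩
    f a                                  ∎
    where
    open ≡-Reasoning
    concentrate : ∀ x → f x ≡ f a * ⟦ does (a ≟ x) ⟧
    concentrate x with a ≟ x
    ... | yes refl = sym (*-identityʳ (f x))
    ... | no a≢x   = trans (vanish x a≢x) (sym (*-zeroʳ (f a)))

  ∑-at : ∀ a (f : A → ℕ) → ∑ xs (λ x → when (does (a ≟ x)) (f x)) ≡ f a
  ∑-at a f = trans (∑-pick a _ vanish) (cong (λ b → when b (f a)) (dec-true (a ≟ a) refl))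
    where
    vanish : ∀ x → a ≢ x → when (does (a ≟ x)) (f x) ≡ 0
    vanish x a≢x = cong (λ b → when b (f x)) (dec-false (a ≟ x) a≢x)

  ∑-at′ : ∀ a (f : A → ℕ) → ∑ xs (λ x → when (does (x ≟ a)) (f x)) ≡ f a
  ∑-at′ a f = trans (∑-cong xs (λ x → cong (λ b → when b (f x)) (≟-sym _≟_ x a))) (∑-at a f)

  ∑-member : ∀ a (f : A → ℕ) → f a ≤ ∑ xs f
  ∑-member a f = begin
    f a                                    ≡⟨ ∑-at a f ⟨
    ∑ xs (λ x → when (does (a ≟ x)) (f x)) ≤⟨ ∑-mono-≤ xs (λ x → when-≤ _ (f x)) ⟩
    ∑ xs f                                 ∎
    where open ≤-Reasoning

vectors : {A : Set} → List A → (n : ℕ) → List (Vec A n)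
vectors xs zero    = [] ∷ []
vectors xs (suc n) = concatMap (λ a → map (a ∷_) (vectors xs n)) xs

module _ {A : Set} (xs : List A) where

  ∑-vectors-suc : ∀ n (f : Vec A (suc n) → ℕ) →
                  ∑ (vectors xs (suc n)) f ≡ ∑ xs (λ a → ∑ (vectors xs n) (λ v → f (a ∷ v)))
  ∑-vectors-suc n f = trans (∑-concatMap _ xs f) (∑-cong xs (λ a → ∑-map (a ∷_) (vectors xs n) f))

  length-vectors : ∀ n → length (vectors xs n) ≡ length xs ^ n
  length-vectors zero    = refl
  length-vectors (suc n) = begin
    length (vectors xs (suc n))                   ≡⟨ length≡∑1 (vectors xs (suc n)) ⟩
    ∑ (vectors xs (suc n)) (λ _ → 1)              ≡⟨ ∑-vectors-suc n (λ _ → 1) ⟩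
    ∑ xs (λ _ → ∑ (vectors xs n) (λ _ → 1))       ≡⟨ ∑-cong xs (λ _ → length≡∑1 (vectors xs n)) ⟨
    ∑ xs (λ _ → length (vectors xs n))            ≡⟨ ∑-cong xs (λ _ → length-vectors n) ⟩
    ∑ xs (λ _ → length xs ^ n)                    ≡⟨ ∑-const xs _ ⟩
    length xs ^ suc n                             ∎
    where open ≡-Reasoning

  vectors-isEnumeration : {_≟_ : DecidableEquality A} → IsEnumeration _≟_ xs →
                          ∀ n → IsEnumeration (≡-dec _≟_) (vectors xs n)
  vectors-isEnumeration {_≟_} enum n = occursOnce (occurs n)
    where
    occurs : ∀ n (v : Vec A n) → ∑ (vectors xs n) (λ w → ⟦ does (≡-dec _≟_ v w) ⟧) ≡ 1
    occurs zero    []      = refl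
    occurs (suc n) (a ∷ v) = begin
      ∑ (vectors xs (suc n)) (λ w → ⟦ does (≡-dec _≟_ (a ∷ v) w) ⟧)
        ≡⟨ ∑-vectors-suc n _ ⟩
      ∑ xs (λ b → ∑ (vectors xs n) (λ w → ⟦ does (a ≟ b) ∧ does (≡-dec _≟_ v w) ⟧))
        ≡⟨ ∑-cong xs (λ b → ∑-cong (vectors xs n) (λ w → ⟦∧⟧ (does (a ≟ b)) _)) ⟩
      ∑ xs (λ b → ∑ (vectors xs n) (λ w → when (does (a ≟ b)) ⟦ does (≡-dec _≟_ v w) ⟧))
        ≡⟨ ∑-cong xs (λ b → ∑-when (vectors xs n) (does (a ≟ b)) _) ⟩
      ∑ xs (λ b → when (does (a ≟ b)) (∑ (vectors xs n) (λ w → ⟦ does (≡-dec _≟_ v w) ⟧)))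
        ≡⟨ ∑-cong xs (λ b → cong (when (does (a ≟ b))) (occurs n v)) ⟩
      ∑ xs (λ b → ⟦ does (a ≟ b) ⟧)
        ≡⟨ occurrences≡1 enum a ⟩
      1                                                                            ∎
      where open ≡-Reasoning

any≡false⇒ : {A : Set} (p : A → Bool) {xs : List A} {x : A} → any p xs ≡ false → x ∈ xs → p x ≡ false
any≡false⇒ p {y ∷ xs} none (here refl) with p y
... | false = refl
any≡false⇒ p {y ∷ xs} none (there x∈xs) with p y
... | false = any≡false⇒ p none x∈xs

⟦any⟧≤∑ : {A : Set} (p : A → Bool) (xs : List A) → ⟦ any p xs ⟧ ≤ ∑ xs (λ x → ⟦ p x ⟧)
⟦any⟧≤∑ p []       = z≤n
⟦any⟧≤∑ p (x ∷ xs) with p x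
... | true  = s≤s z≤n
... | false = ⟦any⟧≤∑ p xs

∑⟦not⟧+∑⟦⟧ : {A : Set} (p : A → Bool) (xs : List A) →
             ∑ xs (λ x → ⟦ not (p x) ⟧) + ∑ xs (λ x → ⟦ p x ⟧) ≡ length xs
∑⟦not⟧+∑⟦⟧ p []       = refl
∑⟦not⟧+∑⟦⟧ p (x ∷ xs) with p x
... | true  = trans (+-suc _ _) (cong suc (∑⟦not⟧+∑⟦⟧ p xs))
... | false = cong suc (∑⟦not⟧+∑⟦⟧ p xs)

1≤⟦nor⟧+⟦⟧+⟦⟧ : ∀ a b → 1 ≤ ⟦ not (a ∨ b) ⟧ + (⟦ a ⟧ + ⟦ b ⟧)
1≤⟦nor⟧+⟦⟧+⟦⟧ true  b     = s≤s z≤n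
1≤⟦nor⟧+⟦⟧+⟦⟧ false true  = s≤s z≤n
1≤⟦nor⟧+⟦⟧+⟦⟧ false false = s≤s z≤n

does≡true⇒ : {P : Set} (p? : Dec P) → does p? ≡ true → P
does≡true⇒ (yes p) _ = p

firstOr : {A : Set} → (A → Bool) → List A → A → A
firstOr p []       a = a
firstOr p (x ∷ xs) a = if p x then x else firstOr p xs a

firstOr-satisfies : {A : Set} (p : A → Bool) (xs : List A) (a : A) →
                    1 ≤ ∑ xs (λ x → ⟦ p x ⟧) → p (firstOr p xs a) ≡ true
firstOr-satisfies p (x ∷ xs) a some with p x in px
... | true  = px
... | false = firstOr-satisfies p xs a some

Proper : {A : Set} {n : ℕ} → Graph n → Vec A n → Set
Proper G v = ∀ u t → G u t ≡ true → lookup v u ≢ lookup v t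

ProperOn : {A : Set} {n : ℕ} → Graph n → (Fin n → Set) → Vec A n → Set
ProperOn G Q v = ∀ u t → Q u → Q t → G u t ≡ true → lookup v u ≢ lookup v t

ProperOn-⊆ : {A : Set} {n : ℕ} {G : Graph n} {Q Q′ : Fin n → Set} (v : Vec A n) →
             (∀ u → Q′ u → Q u) → ProperOn G Q v → ProperOn G Q′ v
ProperOn-⊆ v Q′⊆Q proper u t q′u q′t = proper u t (Q′⊆Q u q′u) (Q′⊆Q t q′t)

[]≔-overwritten : {A : Set} {n : ℕ} (v : Vec A n) {x y : Fin n} → x ≢ y → ∀ a b c e →
                  (((v [ y ]≔ b) [ x ]≔ a) [ y ]≔ e) [ x ]≔ c ≡ (v [ y ]≔ e) [ x ]≔ c
[]≔-overwritten v {x} {y} x≢y a b c e = begin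
  (((v [ y ]≔ b) [ x ]≔ a) [ y ]≔ e) [ x ]≔ c ≡⟨ cong (_[ x ]≔ c) ([]≔-commutes (v [ y ]≔ b) x y x≢y) ⟩
  (((v [ y ]≔ b) [ y ]≔ e) [ x ]≔ a) [ x ]≔ c ≡⟨ cong (λ w → (w [ x ]≔ a) [ x ]≔ c) ([]≔-idempotent v y) ⟩
  ((v [ y ]≔ e) [ x ]≔ a) [ x ]≔ c             ≡⟨ []≔-idempotent (v [ y ]≔ e) x ⟩
  (v [ y ]≔ e) [ x ]≔ c                        ∎
  where open ≡-Reasoning

K≤F+d+d⇒K≤3F : ∀ {K d F} → K ≤ F + (d + d) → 3 * d ≤ K → K ≤ 3 * F
K≤F+d+d⇒K≤3F {K} {d} {F} K≤F+2d 3d≤K = +-cancelʳ-≤ (2 * K) K (3 * F) (begin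
  3 * K                 ≤⟨ *-monoʳ-≤ 3 K≤F+2d ⟩
  3 * (F + (d + d))     ≡⟨ *-distribˡ-+ 3 F (d + d) ⟩
  3 * F + 3 * (d + d)   ≡⟨ cong (λ e → 3 * F + 3 * (d + e)) (+-identityʳ d) ⟨
  3 * F + 3 * (2 * d)   ≡⟨ cong (3 * F +_) (trans (sym (*-assoc 3 2 d)) (*-assoc 2 3 d)) ⟩
  3 * F + 2 * (3 * d)   ≤⟨ +-monoʳ-≤ (3 * F) (*-monoʳ-≤ 2 3d≤K) ⟩
  3 * F + 2 * K         ∎)
  where open ≤-Reasoning

module Palette {A : Set} {_≟_ : DecidableEquality A} {colours : List A} (enum : IsEnumeration _≟_ colours) where

  K : ℕ
  K = length colours

  colourings : (n : ℕ) → List (Vec A n)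
  colourings = vectors colours

  colourings-isEnumeration : ∀ n → IsEnumeration (≡-dec _≟_) (colourings n)
  colourings-isEnumeration = vectors-isEnumeration colours enum

  ∑-update : ∀ {n} (x : Fin n) a (h : Vec A n → ℕ) →
             ∑ (colourings n) (λ v → h (v [ x ]≔ a)) ≡
             K * ∑ (colourings n) (λ v → when (does (a ≟ lookup v x)) (h v))
  ∑-update {suc n} zero a h = begin
    ∑ (colourings (suc n)) (λ v → h (v [ zero ]≔ a))
      ≡⟨ ∑-vectors-suc colours n _ ⟩
    ∑ colours (λ _ → ∑ (colourings n) (λ w → h (a ∷ w)))
      ≡⟨ ∑-const colours _ ⟩
    K * ∑ (colourings n) (λ w → h (a ∷ w))
      ≡⟨ cong (K *_) (∑-cong (colourings n) (λ w → ∑-at enum a (λ b → h (b ∷ w)))) ⟨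
    K * ∑ (colourings n) (λ w → ∑ colours (λ b → when (does (a ≟ b)) (h (b ∷ w))))
      ≡⟨ cong (K *_) (∑-comm (colourings n) colours _) ⟩
    K * ∑ colours (λ b → ∑ (colourings n) (λ w → when (does (a ≟ b)) (h (b ∷ w))))
      ≡⟨ cong (K *_) (∑-vectors-suc colours n _) ⟨
    K * ∑ (colourings (suc n)) (λ v → when (does (a ≟ lookup v zero)) (h v)) ∎
    where open ≡-Reasoning
  ∑-update {suc n} (suc x) a h = begin
    ∑ (colourings (suc n)) (λ v → h (v [ suc x ]≔ a))
      ≡⟨ ∑-vectors-suc colours n _ ⟩
    ∑ colours (λ b → ∑ (colourings n) (λ w → h (b ∷ (w [ x ]≔ a))))
      ≡⟨ ∑-cong colours (λ b → ∑-update x a (λ w → h (b ∷ w))) ⟩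
    ∑ colours (λ b → K * ∑ (colourings n) (λ w → when (does (a ≟ lookup w x)) (h (b ∷ w))))
      ≡⟨ ∑-*ˡ colours K _ ⟩
    K * ∑ colours (λ b → ∑ (colourings n) (λ w → when (does (a ≟ lookup w x)) (h (b ∷ w))))
      ≡⟨ cong (K *_) (∑-vectors-suc colours n _) ⟨
    K * ∑ (colourings (suc n)) (λ v → when (does (a ≟ lookup v (suc x))) (h v)) ∎
    where open ≡-Reasoning

  ∑∑-update : ∀ {n} (x : Fin n) (h : Vec A n → ℕ) →
              ∑ (colourings n) (λ v → ∑ colours (λ a → h (v [ x ]≔ a))) ≡ K * ∑ (colourings n) h
  ∑∑-update {n} x h = begin
    ∑ (colourings n) (λ v → ∑ colours (λ a → h (v [ x ]≔ a)))
      ≡⟨ ∑-comm (colourings n) colours _ ⟩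
    ∑ colours (λ a → ∑ (colourings n) (λ v → h (v [ x ]≔ a)))
      ≡⟨ ∑-cong colours (λ a → ∑-update x a h) ⟩
    ∑ colours (λ a → K * ∑ (colourings n) (λ v → when (does (a ≟ lookup v x)) (h v)))
      ≡⟨ ∑-*ˡ colours K _ ⟩
    K * ∑ colours (λ a → ∑ (colourings n) (λ v → when (does (a ≟ lookup v x)) (h v)))
      ≡⟨ cong (K *_) (∑-comm colours (colourings n) _) ⟩
    K * ∑ (colourings n) (λ v → ∑ colours (λ a → when (does (a ≟ lookup v x)) (h v)))
      ≡⟨ cong (K *_) (∑-cong (colourings n) (λ v → ∑-at′ enum (lookup v x) (λ _ → h v))) ⟩
    K * ∑ (colourings n) h ∎
    where open ≡-Reasoning

  module _ {n : ℕ} (G : Graph n) where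

    proper? : ∀ v → Dec (Proper G v)
    proper? v = all? λ u → all? λ t → (G u t ≟ᵇ true) →-dec ¬? (lookup v u ≟ lookup v t)

    isProper : Vec A n → Bool
    isProper v = does (proper? v)

    isProper⇒Proper : ∀ v → isProper v ≡ true → Proper G v
    isProper⇒Proper v = does≡true⇒ (proper? v)

    blocked : Vec A n → Fin n → A → Bool
    blocked v x c = any (λ u → G x u ∧ does (c ≟ lookup v u)) (allFin n)

    blocked≡false⇒ : ∀ v {x c u} → blocked v x c ≡ false → G x u ≡ true → c ≢ lookup v u
    blocked≡false⇒ v {x} {c} {u} free gxu c≡vu
      with () ← trans (sym (cong₂ _∧_ gxu (dec-true (c ≟ lookup v u) c≡vu))) (any≡false⇒ _ free (∈-allFin u))

    ∑-blocked≤degree : ∀ v x → ∑ colours (λ c → ⟦ blocked v x c ⟧) ≤ degree G x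
    ∑-blocked≤degree v x = begin
      ∑ colours (λ c → ⟦ blocked v x c ⟧)
        ≤⟨ ∑-mono-≤ colours (λ c → ⟦any⟧≤∑ _ (allFin n)) ⟩
      ∑ colours (λ c → ∑ (allFin n) (λ u → ⟦ G x u ∧ does (c ≟ lookup v u) ⟧))
        ≡⟨ ∑-comm colours (allFin n) _ ⟩
      ∑ (allFin n) (λ u → ∑ colours (λ c → ⟦ G x u ∧ does (c ≟ lookup v u) ⟧))
        ≡⟨ ∑-cong (allFin n) (λ u → ∑-cong colours (λ c → ⟦∧⟧ (G x u) _)) ⟩
      ∑ (allFin n) (λ u → ∑ colours (λ c → when (G x u) ⟦ does (c ≟ lookup v u) ⟧))
        ≡⟨ ∑-cong (allFin n) (λ u → ∑-when colours (G x u) _) ⟩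
      ∑ (allFin n) (λ u → when (G x u) (∑ colours (λ c → ⟦ does (c ≟ lookup v u) ⟧)))
        ≡⟨ ∑-cong (allFin n) (λ u → cong (when (G x u)) (∑-at′ enum (lookup v u) (λ _ → 1))) ⟩
      degree G x ∎
      where open ≤-Reasoning

    -- Falls back to the current colour, so no default colour is needed.
    freeColour : Vec A n → Fin n → A
    freeColour v x = firstOr (λ c → not (blocked v x c)) colours (lookup v x)

    recolourGreedily : List (Fin n) → Vec A n → Vec A n
    recolourGreedily []       v = v
    recolourGreedily (x ∷ xs) v = recolourGreedily xs (v [ x ]≔ freeColour v x)

    greedy : Vec A n → Vec A n
    greedy = recolourGreedily (allFin n)

    blocked-update : ∀ v {x y} a c → G x y ≡ false → blocked (v [ y ]≔ a) x c ≡ blocked v x c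
    blocked-update v {x} {y} a c gxy = cong or (map-cong unchanged (allFin n))
      where
      unchanged : ∀ u → (G x u ∧ does (c ≟ lookup (v [ y ]≔ a) u)) ≡ (G x u ∧ does (c ≟ lookup v u))
      unchanged u with u ≟ᶠ y
      ... | yes refl rewrite gxy = refl
      ... | no u≢y   = cong (λ w → G x u ∧ does (c ≟ w)) (lookup∘update′ u≢y v a)

    module _ (simple : IsSimple G) where

      recolour-properOn : ∀ {Q v x c} → ProperOn G Q v → blocked v x c ≡ false →
                          ProperOn G (λ u → u ≡ x ⊎ Q u) (v [ x ]≔ c)
      recolour-properOn {Q} {v} {x} {c} proper free u t qu qt gut with u ≟ᶠ x | t ≟ᶠ x
      ... | yes refl | yes refl with () ← trans (sym gut) (proj₂ simple u)
      ... | yes refl | no t≢x = λ eq →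
        blocked≡false⇒ v free gut (trans (sym (lookup∘update u v c)) (trans eq (lookup∘update′ t≢x v c)))
      ... | no u≢x | yes refl = λ eq →
        blocked≡false⇒ v free (trans (proj₁ simple t u) gut)
          (trans (sym (lookup∘update t v c)) (trans (sym eq) (lookup∘update′ u≢x v c)))
      ... | no u≢x | no t≢x = λ eq →
        proper u t (outside u≢x qu) (outside t≢x qt) gut
          (trans (sym (lookup∘update′ u≢x v c)) (trans eq (lookup∘update′ t≢x v c)))
        where
        outside : ∀ {w} → w ≢ x → w ≡ x ⊎ Q w → Q w
        outside w≢x (inj₁ w≡x) = contradiction w≡x w≢x
        outside w≢x (inj₂ qw)  = qw

      recolour-proper : ∀ {v x c} → Proper G v → blocked v x c ≡ false → Proper G (v [ x ]≔ c)
      recolour-proper {v} proper free u t =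
        recolour-properOn {Q = λ _ → ⊤} {v} (λ u t _ _ → proper u t) free u t (inj₂ tt) (inj₂ tt)

      recolour₂-proper : ∀ {v x y c} → Proper G v → G x y ≡ false →
                         blocked v x c ≡ false → blocked v y c ≡ false → Proper G ((v [ y ]≔ c) [ x ]≔ c)
      recolour₂-proper {v} {y = y} {c} proper gxy xfree yfree =
        recolour-proper {v [ y ]≔ c} (recolour-proper {v} proper yfree) (trans (blocked-update v c c gxy) xfree)

      module _ {d : ℕ} (maxDegree : MaxDegree≤ d G) where

        ∑-blocked≤d : ∀ v x → ∑ colours (λ c → ⟦ blocked v x c ⟧) ≤ d
        ∑-blocked≤d v x = ≤-trans (∑-blocked≤degree v x) (maxDegree x)

        freeColour-free : d < K → ∀ v x → blocked v x (freeColour v x) ≡ false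
        freeColour-free d<K v x = not-injective (firstOr-satisfies _ colours (lookup v x) someFree)
          where
          someFree : 1 ≤ ∑ colours (λ c → ⟦ not (blocked v x c) ⟧)
          someFree = +-cancelʳ-< (∑ colours (λ c → ⟦ blocked v x c ⟧)) 0 _
            (≤-<-trans (∑-blocked≤d v x)
                       (<-≤-trans d<K (≤-reflexive (sym (∑⟦not⟧+∑⟦⟧ (blocked v x) colours)))))

        recolourGreedily-properOn : d < K → ∀ xs {Q} v → ProperOn G Q v →
                                    ProperOn G (λ u → u ∈ xs ⊎ Q u) (recolourGreedily xs v)
        recolourGreedily-properOn d<K [] v proper = ProperOn-⊆ v (λ { u (inj₂ qu) → qu }) proper
        recolourGreedily-properOn d<K (x ∷ xs) {Q} v proper =
          ProperOn-⊆ (recolourGreedily (x ∷ xs) v) shift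
            (recolourGreedily-properOn d<K xs _ (recolour-properOn {v = v} proper (freeColour-free d<K v x)))
          where
          shift : ∀ u → u ∈ x ∷ xs ⊎ Q u → u ∈ xs ⊎ (u ≡ x ⊎ Q u)
          shift u (inj₁ (here u≡x))  = inj₂ (inj₁ u≡x)
          shift u (inj₁ (there u∈xs)) = inj₁ u∈xs
          shift u (inj₂ qu)          = inj₂ (inj₂ qu)

        greedy-proper : d < K → ∀ v → Proper G (greedy v)
        greedy-proper d<K v u t = recolourGreedily-properOn d<K (allFin n) {Q = λ _ → ⊥} v (λ _ _ ()) u t
          (inj₁ (∈-allFin u)) (inj₁ (∈-allFin t))

        commonFree-many : ∀ v x y → K ≤ ∑ colours (λ c → ⟦ not (blocked v x c ∨ blocked v y c) ⟧) + (d + d)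
        commonFree-many v x y = begin
          K
            ≡⟨ trans (sym (*-identityʳ K)) (sym (∑-const colours 1)) ⟩
          ∑ colours (λ _ → 1)
            ≤⟨ ∑-mono-≤ colours (λ c → 1≤⟦nor⟧+⟦⟧+⟦⟧ (bx c) (by c)) ⟩
          ∑ colours (λ c → ⟦ not (bx c ∨ by c) ⟧ + (⟦ bx c ⟧ + ⟦ by c ⟧))
            ≡⟨ trans (∑-+ colours _ _) (cong (F +_) (∑-+ colours (λ c → ⟦ bx c ⟧) (λ c → ⟦ by c ⟧))) ⟩
          F + (∑ colours (λ c → ⟦ bx c ⟧) + ∑ colours (λ c → ⟦ by c ⟧))
            ≤⟨ +-monoʳ-≤ F (+-mono-≤ (∑-blocked≤d v x) (∑-blocked≤d v y)) ⟩
          F + (d + d)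
            ∎
          where
          open ≤-Reasoning
          bx by : A → Bool
          bx = blocked v x
          by = blocked v y
          F = ∑ colours (λ c → ⟦ not (bx c ∨ by c) ⟧)

        module _ (3d≤K : 3 * d ≤ K) where

          diagonalRecolourings-many : ∀ {v x y} → Proper G v → G x y ≡ false →
                                      K ≤ 3 * ∑ colours (λ c → ⟦ isProper ((v [ y ]≔ c) [ x ]≔ c) ⟧)
          diagonalRecolourings-many {v} {x} {y} proper gxy =
            K≤F+d+d⇒K≤3F {d = d} {F = ∑ colours (λ c → ⟦ isProper ((v [ y ]≔ c) [ x ]≔ c) ⟧)}
              (≤-trans (commonFree-many v x y) (+-monoˡ-≤ (d + d) (∑-mono-≤ colours stillProper))) 3d≤K
            where
            stillProper : ∀ c → ⟦ not (blocked v x c ∨ blocked v y c) ⟧ ≤ ⟦ isProper ((v [ y ]≔ c) [ x ]≔ c) ⟧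
            stillProper c with blocked v x c in xfree | blocked v y c in yfree
            ... | true  | _     = z≤n
            ... | false | true  = z≤n
            ... | false | false =
              ≤-reflexive (cong ⟦_⟧ (sym (dec-true (proper? ((v [ y ]≔ c) [ x ]≔ c))
                                                   (recolour₂-proper {v} proper gxy xfree yfree))))

          module _ .{{K≢0 : NonZero K}} {x y : Fin n} (x≢y : x ≢ y) (gxy : G x y ≡ false) (Φ : Vec A n → ℕ)
                   (Φ-x : ∀ v a → Φ (v [ x ]≔ a) ≡ Φ v) (Φ-y : ∀ v a → Φ (v [ y ]≔ a) ≡ Φ v) where

            private
              weight : Vec A n → ℕ
              weight v = when (isProper v) (Φ v)

              recolour₂ : Vec A n → A → A → Vec A n
              recolour₂ v b a = (v [ y ]≔ b) [ x ]≔ a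

              diagonal : Vec A n → ℕ
              diagonal v = ∑ colours (λ c → weight (recolour₂ v c c))

              Φ-recolour₂ : ∀ v b a → Φ (recolour₂ v b a) ≡ Φ v
              Φ-recolour₂ v b a = trans (Φ-x (v [ y ]≔ b) a) (Φ-y v b)

            ∑-recolour₂ :
              ∑ (colourings n) (λ v → ∑ colours (λ b → ∑ colours (λ a → weight (recolour₂ v b a)))) ≡
              K * (K * ∑ (colourings n) weight)
            ∑-recolour₂ = trans (∑∑-update y _) (cong (K *_) (∑∑-update x weight))

            ∑-diagonal : ∑ (colourings n) diagonal ≡
                         K * (K * ∑ (colourings n) (λ v → when (does (lookup v x ≟ lookup v y)) (weight v)))
            ∑-diagonal = begin
              ∑ (colourings n) diagonal
                ≡⟨ ∑-comm (colourings n) colours _ ⟩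
              ∑ colours (λ c → ∑ (colourings n) (λ v → weight (recolour₂ v c c)))
                ≡⟨ ∑-cong colours (λ c → ∑-update y c (λ w → weight (w [ x ]≔ c))) ⟩
              ∑ colours (λ c → K * ∑ (colourings n) (λ v → when (does (c ≟ lookup v y)) (weight (v [ x ]≔ c))))
                ≡⟨ ∑-cong colours (λ c → cong (K *_) (∑-cong (colourings n) (λ v →
                     cong (λ e → when (does (c ≟ e)) (weight (v [ x ]≔ c)))
                          (sym (lookup∘update′ (≢-sym x≢y) v c))))) ⟩
              ∑ colours (λ c → K * ∑ (colourings n) (λ v →
                when (does (c ≟ lookup (v [ x ]≔ c) y)) (weight (v [ x ]≔ c))))
                ≡⟨ ∑-cong colours (λ c → cong (K *_)
                     (∑-update x c (λ w → when (does (c ≟ lookup w y)) (weight w)))) ⟩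
              ∑ colours (λ c → K * (K * ∑ (colourings n) (λ v → atBoth c v)))
                ≡⟨ trans (∑-*ˡ colours K _) (cong (K *_) (∑-*ˡ colours K _)) ⟩
              K * (K * ∑ colours (λ c → ∑ (colourings n) (λ v → atBoth c v)))
                ≡⟨ cong (λ e → K * (K * e)) (∑-comm colours (colourings n) _) ⟩
              K * (K * ∑ (colourings n) (λ v → ∑ colours (λ c → atBoth c v)))
                ≡⟨ cong (λ e → K * (K * e)) (∑-cong (colourings n) (λ v →
                     ∑-at′ enum (lookup v x) (λ c → when (does (c ≟ lookup v y)) (weight v)))) ⟩
              K * (K * ∑ (colourings n) (λ v → when (does (lookup v x ≟ lookup v y)) (weight v))) ∎
              where
              open ≡-Reasoning
              atBoth : A → Vec A n → ℕ
              atBoth c v = when (does (c ≟ lookup v x)) (when (does (c ≟ lookup v y)) (weight v))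

            K*recolour₂≤3*diagonal : ∀ v b a → K * weight (recolour₂ v b a) ≤ 3 * diagonal v
            K*recolour₂≤3*diagonal v b a with isProper (recolour₂ v b a) in proper
            ... | false = ≤-trans (≤-reflexive (*-zeroʳ K)) z≤n
            ... | true  = begin
              K * Φ (recolour₂ v b a)
                ≡⟨ trans (cong (K *_) (Φ-recolour₂ v b a)) (*-comm K (Φ v)) ⟩
              Φ v * K
                ≤⟨ *-monoʳ-≤ (Φ v) (diagonalRecolourings-many {recolour₂ v b a}
                                      (isProper⇒Proper (recolour₂ v b a) proper) gxy) ⟩
              Φ v * (3 * ∑ colours (λ c → ⟦ isProper (recolour₂ (recolour₂ v b a) c c) ⟧))
                ≡⟨ cong (λ e → Φ v * (3 * e)) (∑-cong colours (λ c →
                     cong (⟦_⟧ ∘ isProper) ([]≔-overwritten v x≢y a b c c))) ⟩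
              Φ v * (3 * ∑ colours (λ c → ⟦ isProper (recolour₂ v c c) ⟧))
                ≡⟨ trans (sym (*-assoc (Φ v) 3 S)) (trans (cong (_* S) (*-comm (Φ v) 3)) (*-assoc 3 (Φ v) S)) ⟩
              3 * (Φ v * ∑ colours (λ c → ⟦ isProper (recolour₂ v c c) ⟧))
                ≡⟨ cong (3 *_) (∑-*ˡ colours (Φ v) _) ⟨
              3 * ∑ colours (λ c → Φ v * ⟦ isProper (recolour₂ v c c) ⟧)
                ≡⟨ cong (3 *_) (∑-cong colours (λ c →
                     trans (sym (when≡*⟦⟧ (isProper (recolour₂ v c c)) (Φ v)))
                           (cong (when (isProper (recolour₂ v c c))) (sym (Φ-recolour₂ v c c))))) ⟩
              3 * diagonal v ∎
              where
              open ≤-Reasoning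
              S : ℕ
              S = ∑ colours (λ c → ⟦ isProper (recolour₂ v c c) ⟧)

            collision : ∑ (colourings n) (λ v → when (isProper v) (Φ v)) ≤
                        3 * K * ∑ (colourings n) (λ v → when (does (lookup v x ≟ lookup v y)) (when (isProper v) (Φ v)))
            collision = *-cancelˡ-≤ K (*-cancelˡ-≤ K (*-cancelˡ-≤ K (begin
              K * (K * (K * ∑ (colourings n) weight))
                ≡⟨ cong (K *_) ∑-recolour₂ ⟨
              K * ∑ (colourings n) (λ v → ∑ colours (λ b → ∑ colours (λ a → weight (recolour₂ v b a))))
                ≡⟨ trans (sym (∑-*ˡ (colourings n) K _)) (∑-cong (colourings n) (λ v → K*∑∑ v)) ⟩
              ∑ (colourings n) (λ v → ∑ colours (λ b → ∑ colours (λ a → K * weight (recolour₂ v b a))))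
                ≤⟨ ∑-mono-≤ (colourings n) (λ v → ∑-mono-≤ colours (λ b → ∑-mono-≤ colours (λ a →
                     K*recolour₂≤3*diagonal v b a))) ⟩
              ∑ (colourings n) (λ v → ∑ colours (λ b → ∑ colours (λ a → 3 * diagonal v)))
                ≡⟨ ∑-cong (colourings n) (λ v →
                     trans (∑-cong colours (λ b → ∑-const colours _)) (∑-const colours _)) ⟩
              ∑ (colourings n) (λ v → K * (K * (3 * diagonal v)))
                ≡⟨ trans (∑-*ˡ (colourings n) K _) (cong (K *_) (trans (∑-*ˡ (colourings n) K _)
                     (cong (K *_) (∑-*ˡ (colourings n) 3 diagonal)))) ⟩
              K * (K * (3 * ∑ (colourings n) diagonal))
                ≡⟨ cong (λ e → K * (K * (3 * e))) ∑-diagonal ⟩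
              K * (K * (3 * (K * (K * D))))
                ≡⟨ cong (λ e → K * (K * e)) (trans (x∙yz≈y∙xz 3 K (K * D)) (cong (K *_) (sym (*-assoc 3 K D)))) ⟩
              K * (K * (K * (3 * K * D))) ∎)))
              where
              open ≤-Reasoning
              D : ℕ
              D = ∑ (colourings n) (λ v → when (does (lookup v x ≟ lookup v y)) (weight v))
              K*∑∑ : ∀ v → K * ∑ colours (λ b → ∑ colours (λ a → weight (recolour₂ v b a))) ≡
                           ∑ colours (λ b → ∑ colours (λ a → K * weight (recolour₂ v b a)))
              K*∑∑ v = sym (trans (∑-cong colours (λ b → ∑-*ˡ colours K _)) (∑-*ˡ colours K _))

bits : List Bool
bits = true ∷ false ∷ []

bits-isEnumeration : IsEnumeration _≟ᵇ_ bits
bits-isEnumeration = occursOnce λ { true → refl ; false → refl }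

_≟ˡ_ : {c : ℕ} → DecidableEquality (Label c)
_≟ˡ_ = ≡-dec _≟ᵇ_

bitVectors : (k : ℕ) → List (Label k)
bitVectors = vectors bits

bitVectors-isEnumeration : ∀ k → IsEnumeration _≟ˡ_ (bitVectors k)
bitVectors-isEnumeration = vectors-isEnumeration bits bits-isEnumeration

differ : {c : ℕ} → Label c → Label c → Bool
differ a b = not (does (a ≟ˡ b))

verdict : {n c : ℕ} → (Label c → Label c → Bool) → Graph n → (Fin n → Bool) →
          (Fin n → Label c) → Fin n × Fin n → Bool
verdict D G excluded L (x , y) =
  not (does (x ≟ᶠ y)) ∧ not (excluded x) ∧ not (excluded y) ∧ not (G x y) ∧ D (L x) (L y)

-- excluded marks the vertices queried earlier on the path.
winsAvoiding : {n c : ℕ} → (Label c → Label c → Bool) → Graph n → (Fin n → Bool) →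
               (Fin n → Label c) → Adversary n c → Bool
winsAvoiding D G excluded L (guess x y) = verdict D G excluded L (x , y)
winsAvoiding D G excluded L (query x k) = winsAvoiding D G (λ u → does (u ≟ᶠ x) ∨ excluded u) L (k (L x))

module _ {n c : ℕ} (D : Label c → Label c → Bool) (G : Graph n) where

  verdict-cong : ∀ {e e′} L p → (∀ u → e u ≡ e′ u) → verdict D G e L p ≡ verdict D G e′ L p
  verdict-cong L (x , y) e≗e′ =
    cong₂ (λ a b → not (does (x ≟ᶠ y)) ∧ not a ∧ not b ∧ not (G x y) ∧ D (L x) (L y)) (e≗e′ x) (e≗e′ y)

  winsAvoiding-run : ∀ A excluded L →
    winsAvoiding D G excluded L A ≡ verdict D G (λ u → u ∈ᵇ proj₁ (run A L) ∨ excluded u) L (proj₂ (run A L))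
  winsAvoiding-run (guess x y) excluded L = refl
  winsAvoiding-run (query x k) excluded L
    with run (k (L x)) L | winsAvoiding-run (k (L x)) (λ u → does (u ≟ᶠ x) ∨ excluded u) L
  ... | qs , p | ih = trans ih (verdict-cong L p (λ u → regroup (does (u ≟ᶠ x)) (u ∈ᵇ qs) (excluded u)))
    where
    regroup : ∀ a b e → b ∨ (a ∨ e) ≡ (a ∨ b) ∨ e
    regroup a b e = trans (sym (∨-assoc b a e)) (cong (_∨ e) (∨-comm b a))

  wins≡winsAvoiding : ∀ L A → wins D G L A ≡ winsAvoiding D G (λ _ → false) L A
  wins≡winsAvoiding L A with run A L | winsAvoiding-run A (λ _ → false) L
  ... | qs , (x , y) | eq rewrite ∨-identityʳ (x ∈ᵇ qs) | ∨-identityʳ (y ∈ᵇ qs) = sym eq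

module _ (k : ℕ) where

  open Palette (bitVectors-isEnumeration k)

  module _ {n : ℕ} {G : Graph n} (simple : IsSimple G) {d : ℕ} (maxDegree : MaxDegree≤ d G)
           (3d≤K : 3 * d ≤ K) .{{K≢0 : NonZero K}} where

    m≤3K*m : ∀ {m} → m ≤ 3 * K * m
    m≤3K*m {m} = m≤n*m m (3 * K) {{m*n≢0 3 K}}

    -- Φ weights colourings by the answers received so far (Φ′ below); its invariance under
    -- recolouring unqueried vertices is what collision needs at the guess.
    ∑-proper≤3K*∑-losing :
      ∀ A excluded (Φ : Vec (Label k) n → ℕ) → (∀ v u a → excluded u ≡ false → Φ (v [ u ]≔ a) ≡ Φ v) →
      ∑ (colourings n) (λ v → when (isProper G v) (Φ v)) ≤
      3 * K * ∑ (colourings n) (λ v → when (isProper G v) (when (not (winsAvoiding differ G excluded (lookup v) A)) (Φ v)))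
    ∑-proper≤3K*∑-losing (guess x y) excluded Φ Φ-inv
      with x ≟ᶠ y | excluded x in ex | excluded y in ey | G x y in gxy
    ... | yes _   | _     | _     | _     = m≤3K*m
    ... | no _    | true  | _     | _     = m≤3K*m
    ... | no _    | false | true  | _     = m≤3K*m
    ... | no _    | false | false | true  = m≤3K*m
    ... | no x≢y  | false | false | false =
      ≤-trans (collision G simple maxDegree 3d≤K x≢y gxy Φ (λ v a → Φ-inv v x a ex) (λ v a → Φ-inv v y a ey))
        (≤-reflexive (cong (3 * K *_) (∑-cong (colourings n) (λ v →
          trans (when-comm _ (isProper G v) (Φ v))
                (cong (λ b → when (isProper G v) (when b (Φ v))) (sym (not-involutive _)))))))
    ∑-proper≤3K*∑-losing (query x next) excluded Φ Φ-inv = begin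
      ∑ (colourings n) (λ v → when (isProper G v) (Φ v))
        ≡⟨ ∑-cong (colourings n) split ⟩
      ∑ (colourings n) (λ v → ∑ (bitVectors k) (λ l → when (isProper G v) (Φ′ l v)))
        ≡⟨ ∑-comm (colourings n) (bitVectors k) _ ⟩
      ∑ (bitVectors k) (λ l → ∑ (colourings n) (λ v → when (isProper G v) (Φ′ l v)))
        ≤⟨ ∑-mono-≤ (bitVectors k) (λ l → ∑-proper≤3K*∑-losing (next l) excluded′ (Φ′ l) (Φ′-inv l)) ⟩
      ∑ (bitVectors k) (λ l → 3 * K * ∑ (colourings n) (λ v → losing l v))
        ≡⟨ ∑-*ˡ (bitVectors k) (3 * K) _ ⟩
      3 * K * ∑ (bitVectors k) (λ l → ∑ (colourings n) (λ v → losing l v))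
        ≡⟨ cong (3 * K *_) (∑-comm (bitVectors k) (colourings n) _) ⟩
      3 * K * ∑ (colourings n) (λ v → ∑ (bitVectors k) (λ l → losing l v))
        ≡⟨ cong (3 * K *_) (∑-cong (colourings n) answered) ⟩
      3 * K * ∑ (colourings n) (λ v → when (isProper G v)
                                        (when (not (winsAvoiding differ G excluded (lookup v) (query x next))) (Φ v))) ∎
      where
      open ≤-Reasoning
      excluded′ : Fin n → Bool
      excluded′ u = does (u ≟ᶠ x) ∨ excluded u
      Φ′ : Label k → Vec (Label k) n → ℕ
      Φ′ l v = when (does (l ≟ˡ lookup v x)) (Φ v)
      losing : Label k → Vec (Label k) n → ℕ
      losing l v = when (isProper G v) (when (not (winsAvoiding differ G excluded′ (lookup v) (next l))) (Φ′ l v))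
      split : ∀ v → when (isProper G v) (Φ v) ≡ ∑ (bitVectors k) (λ l → when (isProper G v) (Φ′ l v))
      split v = sym (trans (∑-when (bitVectors k) (isProper G v) (λ l → Φ′ l v))
                           (cong (when (isProper G v)) (∑-at′ (bitVectors-isEnumeration k) (lookup v x) (λ _ → Φ v))))
      Φ′-inv : ∀ l v u a → excluded′ u ≡ false → Φ′ l (v [ u ]≔ a) ≡ Φ′ l v
      Φ′-inv l v u a outside with u ≟ᶠ x | excluded u in eu
      ... | no u≢x | false =
        cong₂ (λ e m → when (does (l ≟ˡ e)) m) (lookup∘update′ (≢-sym u≢x) v a) (Φ-inv v u a eu)
      answered : ∀ v → ∑ (bitVectors k) (λ l → losing l v) ≡
                 when (isProper G v) (when (not (winsAvoiding differ G excluded (lookup v) (query x next))) (Φ v))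
      answered v = trans (∑-pick (bitVectors-isEnumeration k) (lookup v x) (λ l → losing l v) vanish)
                         (cong (λ b → when (isProper G v) (when (not won) (when b (Φ v))))
                               (dec-true (lookup v x ≟ˡ lookup v x) refl))
        where
        won : Bool
        won = winsAvoiding differ G excluded′ (lookup v) (next (lookup v x))
        vanish : ∀ l → lookup v x ≢ l → losing l v ≡ 0
        vanish l vx≢l rewrite dec-false (l ≟ˡ lookup v x) (≢-sym vx≢l) =
          trans (cong (when (isProper G v)) (when-0 _)) (when-0 _)

⌊n/2⌋+⌊n/2⌋≤n : ∀ n → ⌊ n /2⌋ + ⌊ n /2⌋ ≤ n
⌊n/2⌋+⌊n/2⌋≤n n = ≤-trans (+-monoʳ-≤ ⌊ n /2⌋ (⌊n/2⌋≤⌈n/2⌉ n)) (≤-reflexive (⌊n/2⌋+⌈n/2⌉≡n n))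

n≤1+⌊n/2⌋+⌊n/2⌋ : ∀ n → n ≤ suc (⌊ n /2⌋ + ⌊ n /2⌋)
n≤1+⌊n/2⌋+⌊n/2⌋ zero          = z≤n
n≤1+⌊n/2⌋+⌊n/2⌋ (suc zero)    = s≤s z≤n
n≤1+⌊n/2⌋+⌊n/2⌋ (suc (suc n)) rewrite +-suc ⌊ n /2⌋ ⌊ n /2⌋ = s≤s (s≤s (n≤1+⌊n/2⌋+⌊n/2⌋ n))

2^⌊log2⌋≤n : ∀ n (rec : Acc _<_ n) → 1 ≤ n → 2 ^ ⌊log2⌋ n rec ≤ n
2^⌊log2⌋≤n (suc zero)    _         _ = s≤s z≤n
2^⌊log2⌋≤n (suc (suc m)) (acc rec) _ = begin
  2 * 2 ^ ⌊log2⌋ (suc h) _   ≤⟨ *-monoʳ-≤ 2 (2^⌊log2⌋≤n (suc h) _ (s≤s z≤n)) ⟩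
  2 * suc h                  ≡⟨ *-suc 2 h ⟩
  2 + (h + (h + 0))          ≡⟨ cong (λ e → 2 + (h + e)) (+-identityʳ h) ⟩
  2 + (h + h)                ≤⟨ s≤s (s≤s (⌊n/2⌋+⌊n/2⌋≤n m)) ⟩
  suc (suc m)                ∎
  where
  open ≤-Reasoning
  h : ℕ
  h = ⌊ m /2⌋

n<2^[1+⌊log2⌋] : ∀ n (rec : Acc _<_ n) → n < 2 ^ suc (⌊log2⌋ n rec)
n<2^[1+⌊log2⌋] zero          _         = s≤s z≤n
n<2^[1+⌊log2⌋] (suc zero)    _         = s≤s (s≤s z≤n)
n<2^[1+⌊log2⌋] (suc (suc m)) (acc rec) = begin-strict
  suc (suc m)                    <⟨ s≤s (s≤s (s≤s (n≤1+⌊n/2⌋+⌊n/2⌋ m))) ⟩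
  4 + (h + h)                    ≡⟨ cong (λ e → 4 + (h + e)) (+-identityʳ h) ⟨
  4 + 2 * h                      ≡⟨ trans (*-suc 2 (suc h)) (cong (2 +_) (*-suc 2 h)) ⟨
  2 * suc (suc h)                ≤⟨ *-monoʳ-≤ 2 (n<2^[1+⌊log2⌋] (suc h) _) ⟩
  2 * 2 ^ suc (⌊log2⌋ (suc h) _) ∎
  where
  open ≤-Reasoning
  h : ℕ
  h = ⌊ m /2⌋

2^⌊log₂n⌋≤n : ∀ n → 1 ≤ n → 2 ^ ⌊log₂ n ⌋ ≤ n
2^⌊log₂n⌋≤n n = 2^⌊log2⌋≤n n (<-wellFounded n)

n<2^[1+⌊log₂n⌋] : ∀ n → n < 2 ^ suc ⌊log₂ n ⌋
n<2^[1+⌊log₂n⌋] n = n<2^[1+⌊log2⌋] n (<-wellFounded n)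

3d≤2^[3+⌊log₂d⌋] : ∀ d → 3 * d ≤ 2 ^ (3 + ⌊log₂ d ⌋)
3d≤2^[3+⌊log₂d⌋] d = begin
  3 * d                     ≤⟨ *-monoˡ-≤ d (n≤1+n 3) ⟩
  4 * d                     ≤⟨ *-monoʳ-≤ 4 (<⇒≤ (n<2^[1+⌊log₂n⌋] d)) ⟩
  4 * 2 ^ suc ⌊log₂ d ⌋     ≡⟨ *-assoc 2 2 (2 ^ suc ⌊log₂ d ⌋) ⟩
  2 ^ (3 + ⌊log₂ d ⌋)       ∎
  where open ≤-Reasoning

2^[3+⌊log₂d⌋]≤8d : ∀ d → 1 ≤ d → 2 ^ (3 + ⌊log₂ d ⌋) ≤ 8 * d
2^[3+⌊log₂d⌋]≤8d d 1≤d = begin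
  2 ^ (3 + ⌊log₂ d ⌋)       ≡⟨ trans (*-assoc 2 4 y) (cong (2 *_) (*-assoc 2 2 y)) ⟨
  8 * 2 ^ ⌊log₂ d ⌋         ≤⟨ *-monoʳ-≤ 8 (2^⌊log₂n⌋≤n d 1≤d) ⟩
  8 * d                     ∎
  where
  open ≤-Reasoning
  y : ℕ
  y = 2 ^ ⌊log₂ d ⌋

forgery-arithmetic : ∀ {b w l d M} → b ≤ 1 → 1 ≤ w + l → w + l ≤ M * l → M ≤ 24 * d → 1 ≤ d →
                     (b + w) * (25 * d) + 1 * suc (w + l) ≤ 25 * d * suc (w + l)
forgery-arithmetic {w = w} {zero} {M = M} _ 1≤T T≤Ml _ _
  with () ← ≤-trans 1≤T (≤-trans T≤Ml (≤-reflexive (*-zeroʳ M)))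
forgery-arithmetic {b} {w} {l@(suc _)} {d} {M} b≤1 _ T≤Ml M≤24d 1≤d = begin
  (b + w) * Q + 1 * suc T   ≤⟨ +-mono-≤ (*-monoˡ-≤ Q (+-monoˡ-≤ w b≤1)) (≤-reflexive (*-identityˡ (suc T))) ⟩
  (1 + w) * Q + suc T       ≤⟨ +-monoʳ-≤ ((1 + w) * Q) 1+T≤Ql ⟩
  (1 + w) * Q + Q * l       ≡⟨ cong (_+ Q * l) (*-comm (1 + w) Q) ⟩
  Q * (1 + w) + Q * l       ≡⟨ *-distribˡ-+ Q (1 + w) l ⟨
  Q * suc T                 ∎
  where
  open ≤-Reasoning
  Q T : ℕ
  Q = 25 * d
  T = w + l
  1+T≤Ql : suc T ≤ Q * l
  1+T≤Ql = begin
    suc T                   ≤⟨ +-mono-≤ (s≤s z≤n) T≤Ml ⟩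
    l + M * l               ≡⟨ cong (_+ M * l) (*-identityˡ l) ⟨
    1 * l + M * l           ≤⟨ +-mono-≤ (*-monoˡ-≤ l 1≤d) (*-monoˡ-≤ l M≤24d) ⟩
    d * l + 24 * d * l      ≡⟨ *-distribʳ-+ l d (24 * d) ⟨
    Q * l                   ∎

module _ (k : ℕ) where

  open Palette (bitVectors-isEnumeration k)

  -- The greedy colouring is an extra seed keeping the seed space non-empty for graphs without
  -- a proper colouring; inside the family it is proper and costs the b ≤ 1 in forgery-arithmetic.
  seedColourings : (n : ℕ) → Graph n → List (Vec (Label k) n)
  seedColourings n G = greedy G (replicate n (replicate k false)) ∷ filter (proper? G) (colourings n)

  scheme : Scheme k
  scheme = record
    { seeds     = λ n G → length (seedColourings n G)
    ; seeds-pos = λ _ _ → s≤s z≤n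
    ; encode    = λ n G s → lookup (List.lookup (seedColourings n G) s)
    ; decode    = differ
    }

  module _ {d : ℕ} (1≤d : 1 ≤ d) (3d≤K : 3 * d ≤ K) where

    d<K : d < K
    d<K = <-≤-trans (m<m+n d (≤-trans 1≤d (m≤m+n d _))) 3d≤K

    instance
      K≢0 : NonZero K
      K≢0 = >-nonZero (≤-<-trans z≤n d<K)

    scheme-complete : Complete d scheme
    scheme-complete n G simple maxDegree s u v guv =
      cong not (dec-false (_ ≟ˡ _) (All.lookup seeds-proper (∈-lookup s) u v guv))
      where
      seeds-proper : All (Proper G) (seedColourings n G)
      seeds-proper = greedy-proper G simple maxDegree d<K _ ∷ all-filter (proper? G) (colourings n)

    scheme-forgery : K ≤ 8 * d → ForgeryBound d 1 25 scheme
    scheme-forgery K≤8d n G simple maxDegree A =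
      subst₂ (λ wc sd → wc * (25 * d) + 1 * sd ≤ 25 * d * sd) (sym winCount≡) (sym seeds≡)
        (forgery-arithmetic (when-≤ (won g) 1) 1≤T T≤3K*l 3K≤24d 1≤d)
      where
      open ≤-Reasoning
      g : Vec (Label k) n
      g = greedy G (replicate n (replicate k false))
      won : Vec (Label k) n → Bool
      won v = wins differ G (lookup v) A
      w l : ℕ
      w = ∑ (colourings n) (λ v → when (isProper G v) ⟦ won v ⟧)
      l = ∑ (colourings n) (λ v → when (isProper G v) ⟦ not (won v) ⟧)
      winCount≡ : winCount scheme n G A ≡ ⟦ won g ⟧ + w
      winCount≡ = trans (∑-allFin-lookup (seedColourings n G) (λ v → ⟦ won v ⟧))
                        (cong (⟦ won g ⟧ +_) (∑-filter (proper? G) (colourings n) (λ v → ⟦ won v ⟧)))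
      T≡w+l : ∑ (colourings n) (λ v → when (isProper G v) 1) ≡ w + l
      T≡w+l = trans (∑-cong (colourings n) split) (∑-+ (colourings n) _ _)
        where
        split : ∀ v → when (isProper G v) 1 ≡ when (isProper G v) ⟦ won v ⟧ + when (isProper G v) ⟦ not (won v) ⟧
        split v with isProper G v | won v
        ... | true  | true  = refl
        ... | true  | false = refl
        ... | false | _     = refl
      seeds≡ : seeds scheme n G ≡ suc (w + l)
      seeds≡ = cong suc (trans (length≡∑1 (filter (proper? G) (colourings n)))
                        (trans (∑-filter (proper? G) (colourings n) (λ _ → 1)) T≡w+l))
      g-proper : Proper G g
      g-proper = greedy-proper G simple maxDegree d<K _
      1≤T : 1 ≤ w + l
      1≤T = begin
        1                                              ≡⟨ cong (λ b → when b 1) (dec-true (proper? G g) g-proper) ⟨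
        when (isProper G g) 1                          ≤⟨ ∑-member (colourings-isEnumeration n) g _ ⟩
        ∑ (colourings n) (λ v → when (isProper G v) 1) ≡⟨ T≡w+l ⟩
        w + l                                          ∎
      T≤3K*l : w + l ≤ 3 * K * l
      T≤3K*l = begin
        w + l
          ≡⟨ T≡w+l ⟨
        ∑ (colourings n) (λ v → when (isProper G v) 1)
          ≤⟨ ∑-proper≤3K*∑-losing k simple maxDegree 3d≤K A (λ _ → false) (λ _ → 1) (λ _ _ _ _ → refl) ⟩
        3 * K * ∑ (colourings n) (λ v → when (isProper G v) ⟦ not (winsAvoiding differ G (λ _ → false) (lookup v) A) ⟧)
          ≡⟨ cong (3 * K *_) (∑-cong (colourings n) (λ v →
               cong (λ b → when (isProper G v) ⟦ not b ⟧) (sym (wins≡winsAvoiding differ G (lookup v) A)))) ⟩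
        3 * K * l
          ∎
      3K≤24d : 3 * K ≤ 24 * d
      3K≤24d = ≤-trans (*-monoʳ-≤ 3 K≤8d) (≤-reflexive (sym (*-assoc 3 8 d)))

3+n≤3*[1+n] : ∀ n → 3 + n ≤ 3 * suc n
3+n≤3*[1+n] n = ≤-trans (+-monoʳ-≤ 3 (m≤n*m n 3)) (≤-reflexive (sym (*-suc 3 n)))

theorem3p1 : Σ ℕ λ C → Σ ℕ λ p → Σ ℕ λ q → (1 ≤ p) × (1 ≤ q) ×
    (∀ (d : ℕ) → 1 ≤ d →
      Σ ℕ λ c → (c ≤ C * suc ⌊log₂ d ⌋) ×
        Σ (Scheme c) λ S → Complete d S × ForgeryBound d p q S)
theorem3p1 = 3 , 1 , 25 , s≤s z≤n , s≤s z≤n , λ d 1≤d →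
  let k     = 3 + ⌊log₂ d ⌋
      K≡2^k = length-vectors bits k
      3d≤K  = subst (3 * d ≤_) (sym K≡2^k) (3d≤2^[3+⌊log₂d⌋] d)
      K≤8d  = subst (_≤ 8 * d) (sym K≡2^k) (2^[3+⌊log₂d⌋]≤8d d 1≤d)
  in k , 3+n≤3*[1+n] ⌊log₂ d ⌋ , scheme k , scheme-complete k 1≤d 3d≤K , scheme-forgery k 1≤d 3d≤K K≤8d
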